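{- Let $D$ be a defeasible theory and let $\mathcal Q=\{\mathtt{defeasibly},\mathtt{overruled},\mathtt{defeated},\mathtt{loop\_defeasibly}\}$. Then (a) $\mathcal M_{\partial_{||}}(D)$ has a signing $s$ for $\mathcal Q$ such that $s(\mathtt{defeasibly})=+1$ and $\mathtt{defeasibly}$ avoids negative unfoundedness with respect to $s$ and $\mathcal Q$; and (b) $\mathcal M_{\partial^*_{||}}(D)$ has a signing $s$ for $\mathcal Q$ such that $s(\mathtt{defeasibly})=+1$ and $\mathtt{defeasibly}$ avoids negative unfoundedness with respect to $s$ and $\mathcal Q$.
   Context: Defeasible theories. A literal is an atom $p(t_1,\dots,t_n)$ or its classical negation. A defeasible theory $D=(F,R,>)$ consists of a finite set $F$ of variable-free literals (facts), a finite set $R$ of labelled rules with a finite antecedent set of literals, a consequent literal and a kind strict ($\to$), defeasible ($\Rightarrow$) or defeater ($\leadsto$), and an acyclic superiority relation $>$ on labels. Metaprograms. $D$ is represented by unit clauses $\mathtt{fact}(q)$ ($q\in F$), $\mathtt{strict}(r,q,[q_1,\dots,q_n])$, $\mathtt{defeasible}(r,q,[q_1,\dots,q_n])$, $\mathtt{defeater}(r,q,[q_1,\dots,q_n])$ (rules $r:q_1,\dots,q_n\hookrightarrow q$ of the respective kind), $\mathtt{sup}(r,s)$ ($r>s$); predicates of $D$ are function symbols and $\neg p(\vec t)$ is written $\mathtt{not\_p}(\vec t)$; for each predicate $p$ also $\mathtt{neg}(\mathtt{p}(\vec X),\mathtt{not\_p}(\vec X))$ and $\mathtt{neg}(\mathtt{not\_p}(\vec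 X),\mathtt{p}(\vec X))$. $\mathcal M_{\partial_{||}}(D)$ is this with: $\mathtt{rule}(R,H,B)\,\text{:- }\,\mathtt{strict\_or\_defeasible}(R,H,B)$; $\mathtt{rule}(R,H,B)\,\text{:- }\,\mathtt{defeater}(R,H,B)$; $\mathtt{strict\_or\_defeasible}(R,H,B)\,\text{:- }\,\mathtt{strict}(R,H,B)$; $\mathtt{strict\_or\_defeasible}(R,H,B)\,\text{:- }\,\mathtt{defeasible}(R,H,B)$; for $\tau\in\{\mathtt{definitely},\mathtt{lambda},\mathtt{defeasibly}\}$: $\mathtt{loop\_}\tau([\,])$, $\mathtt{loop\_}\tau([H|T])\,\text{:- }\,\tau(H),\mathtt{loop\_}\tau(T)$; $\mathtt{definitely}(X)\,\text{:- }\,\mathtt{fact}(X)$; $\mathtt{definitely}(X)\,\text{:- }\,\mathtt{strict}(R,X,Y),\mathtt{loop\_definitely}(Y)$; $\mathtt{lambda}(X)\,\text{:- }\,\mathtt{definitely}(X)$; $\mathtt{lambda}(X)\,\text{:- }\,\mathtt{neg}(X,X'),\ not\ \mathtt{definitely}(X'),\ \mathtt{strict\_or\_defeasible}(R,X,Y),\ \mathtt{loop\_lambda}(Y)$; $\mathtt{defeasibly}(X)\,\text{:- }\,\mathtt{definitely}(X)$; $\mathtt{defeasibly}(X)\,\text{:- }\,\mathtt{neg}(X,X'),\ not\ \mathtt{definitely}(X'),\ \mathtt{strict\_or\_defeasible}(R,X,Y),\ \mathtt{loop\_defeasibly}(Y),\ not\ \mathtt{overruled}(X)$; $\mathtt{overruled}(X)\,\text{:-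 }\,\mathtt{neg}(X,X'),\ \mathtt{rule}(S,X',U),\ \mathtt{loop\_lambda}(U),\ not\ \mathtt{defeated}(S,X')$; $\mathtt{defeated}(S,X')\,\text{:- }\,\mathtt{neg}(X,X'),\ \mathtt{sup}(T,S),\ \mathtt{strict\_or\_defeasible}(T,X,V),\ \mathtt{loop\_defeasibly}(V)$. $\mathcal M_{\partial^*_{||}}(D)$ is identical except its last three clauses are replaced by: $\mathtt{defeasibly}(X)\,\text{:- }\,\mathtt{neg}(X,X'),\ not\ \mathtt{definitely}(X'),\ \mathtt{strict\_or\_defeasible}(R,X,Y),\ \mathtt{loop\_defeasibly}(Y),\ not\ \mathtt{overruled}(R,X)$; $\mathtt{overruled}(R,X)\,\text{:- }\,\mathtt{neg}(X,X'),\ \mathtt{rule}(S,X',U),\ \mathtt{loop\_lambda}(U),\ not\ \mathtt{defeats}(R,S)$; $\mathtt{defeats}(R,S)\,\text{:- }\,\mathtt{sup}(R,S)$. Dependencies. $p\sqsupseteq_{+1}q$ ($p\sqsupseteq_{ -1}q$) if some clause has head predicate $p$ and a positive (negative) body literal with predicate $q$; $p\sqsupseteq q$ if either holds; $\geq$ is the transitive closure of $\sqsupseteq$ ($p$ depends on $q$ if $p\geq q$). $\geq_{+1},\geq_{ -1}$ are the least relations with $p\geq_{+1}p$ and ($p\sqsupseteq_i q$, $q\geq_j r$ imply $p\geq_{i\cdot j}r$); $q\leq_i p$ means $p\geq_i q$. A signing for a set $\mathcal Q$ of predicates is a function $s$ from predicates to $\{ -1,+1\}$ such that for $p,q\in\mathcal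 Q$, $p\leq_i q$ implies $s(p)=s(q)\cdot i$. An infinite sequence of atoms $q_1(\vec a_1),q_2(\vec a_2),\dots$ is unfounded with respect to $\mathcal Q$ if $q_i\sqsupseteq_{+1}q_{i+1}$ and $q_i\in\mathcal Q$ for all $i$. A predicate $p$ avoids negative unfoundedness with respect to a signing $s$ on $\mathcal Q$ if for every predicate $q$ with $s(q)=-1$ on which $p$ depends, no $q$-atom starts a sequence that is unfounded with respect to $\mathcal Q$. -}

module Defs where

open import Data.Nat using (ℕ; zero; suc)
open import Data.Bool using (Bool; true; false)
open import Data.List using (List; []; _∷_; _++_; map; concatMap; length; upTo)
open import Data.List.Membership.Propositional using (_∈_)
open import Data.List.Relation.Unary.All using (All)
open import Data.Product using (_×_; _,_; Σ; ∃)
open import Relation.Binary.PropositionalEquality using (_≡_)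
open import Relation.Binary.Construct.Closure.Transitive using (TransClosure)
open import Relation.Nullary using (¬_)

data DTerm : Set where
  dvar : ℕ → DTerm
  dfn  : ℕ → List DTerm → DTerm

mutual
  data GroundTerm : DTerm → Set where
    gfn : ∀ {f ts} → GroundTerms ts → GroundTerm (dfn f ts)

  data GroundTerms : List DTerm → Set where
    []  : GroundTerms []
    _∷_ : ∀ {t ts} → GroundTerm t → GroundTerms ts → GroundTerms (t ∷ ts)

record Literal : Set where
  constructor lit
  field
    pred     : ℕ
    positive : Bool
    args     : List DTerm

GroundLiteral : Literal → Set
GroundLiteral l = GroundTerms (Literal.args l)

data Kind : Set where
  strictK defeasibleK defeaterK : Kind

record Rule : Set where
  constructor mkRule
  field
    label      : ℕ
    kind       : Kind
    antecedent : List Literal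
    consequent : Literal

-- r > s is represented by (r , s) ∈ sup.
SupRel : List (ℕ × ℕ) → ℕ → ℕ → Set
SupRel sup r s = (r , s) ∈ sup

record DefeasibleTheory : Set where
  field
    facts       : List Literal
    rules       : List Rule
    sup         : List (ℕ × ℕ)
    factsGround : All GroundLiteral facts
    supAcyclic  : ∀ r → ¬ TransClosure (SupRel sup) r r

data MPred : Set where
  fact strict defeasible defeater sup neg rule strict-or-defeasible : MPred
  loop-definitely loop-lambda loop-defeasibly : MPred
  definitely lambda defeasibly overruled defeated defeats : MPred

data Sym : Set where
  usr  : ℕ → Sym   -- function symbols / constants of D
  prd  : ℕ → Sym   -- predicate p of D used as a function symbol  p
  nprd : ℕ → Sym   -- the function symbol  not_p
  lbl  : ℕ → Sym
  nil  : Sym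
  cons : Sym

data Term : Set where
  var : ℕ → Term
  app : Sym → List Term → Term

infix 30 _⟨_⟩
infix 2 _:-_

data Atom : Set where
  _⟨_⟩ : MPred → List Term → Atom

predOf : Atom → MPred
predOf (p ⟨ _ ⟩) = p

data BodyLit : Set where
  pos : Atom → BodyLit
  naf : Atom → BodyLit

record Clause : Set where
  constructor _:-_
  field
    head : Atom
    body : List BodyLit

Program : Set
Program = List Clause

mutual
  encTerm : DTerm → Term
  encTerm (dvar n)    = var n
  encTerm (dfn f ts)  = app (usr f) (encTerms ts)

  encTerms : List DTerm → List Term
  encTerms []       = []
  encTerms (t ∷ ts) = encTerm t ∷ encTerms ts

encLit : Literal → Term
encLit (lit p true  ts) = app (prd p)  (encTerms ts)
encLit (lit p false ts) = app (nprd p) (encTerms ts)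

encList : List Term → Term
encList []       = app nil []
encList (t ∷ ts) = app cons (t ∷ encList ts ∷ [])

lblT : ℕ → Term
lblT r = app (lbl r) []

factClause : Literal → Clause
factClause q = fact ⟨ encLit q ∷ [] ⟩ :- []

kindPred : Kind → MPred
kindPred strictK     = strict
kindPred defeasibleK = defeasible
kindPred defeaterK   = defeater

ruleClause : Rule → Clause
ruleClause (mkRule r k qs q) =
  kindPred k ⟨ lblT r ∷ encLit q ∷ encList (map encLit qs) ∷ [] ⟩ :- []

supClause : ℕ × ℕ → Clause
supClause (r , s) = sup ⟨ lblT r ∷ lblT s ∷ [] ⟩ :- []

negClauses : Literal → List Clause
negClauses (lit p _ ts) =
  let xs = map var (upTo (length ts)) in
  (neg ⟨ app (prd p) xs ∷ app (nprd p) xs ∷ [] ⟩ :- []) ∷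
  (neg ⟨ app (nprd p) xs ∷ app (prd p) xs ∷ [] ⟩ :- []) ∷ []

literalsOf : DefeasibleTheory → List Literal
literalsOf D = DefeasibleTheory.facts D
  ++ concatMap (λ r → Rule.consequent r ∷ Rule.antecedent r) (DefeasibleTheory.rules D)

theoryClauses : DefeasibleTheory → Program
theoryClauses D =
     map factClause (DefeasibleTheory.facts D)
  ++ map ruleClause (DefeasibleTheory.rules D)
  ++ map supClause (DefeasibleTheory.sup D)
  ++ concatMap negClauses (literalsOf D)

private
  vR vH vB vX vX' vY vS vU vT vV : Term
  vR = var 0 ; vH = var 1 ; vB = var 2 ; vX = var 3 ; vX' = var 4
  vY = var 5 ; vS = var 6 ; vU = var 7 ; vT = var 8 ; vV = var 9

  loopClauses : MPred → MPred → List Clause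
  loopClauses loopτ τ =
    (loopτ ⟨ app nil [] ∷ [] ⟩ :- []) ∷
    (loopτ ⟨ app cons (vH ∷ vT ∷ []) ∷ [] ⟩
       :- (pos (τ ⟨ vH ∷ [] ⟩) ∷ pos (loopτ ⟨ vT ∷ [] ⟩) ∷ [])) ∷ []

commonClauses : Program
commonClauses =
    (rule ⟨ vR ∷ vH ∷ vB ∷ [] ⟩ :- (pos (strict-or-defeasible ⟨ vR ∷ vH ∷ vB ∷ [] ⟩) ∷ []))
  ∷ (rule ⟨ vR ∷ vH ∷ vB ∷ [] ⟩ :- (pos (defeater ⟨ vR ∷ vH ∷ vB ∷ [] ⟩) ∷ []))
  ∷ (strict-or-defeasible ⟨ vR ∷ vH ∷ vB ∷ [] ⟩ :- (pos (strict ⟨ vR ∷ vH ∷ vB ∷ [] ⟩) ∷ []))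
  ∷ (strict-or-defeasible ⟨ vR ∷ vH ∷ vB ∷ [] ⟩ :- (pos (defeasible ⟨ vR ∷ vH ∷ vB ∷ [] ⟩) ∷ []))
  ∷ (definitely ⟨ vX ∷ [] ⟩ :- (pos (fact ⟨ vX ∷ [] ⟩) ∷ []))
  ∷ (definitely ⟨ vX ∷ [] ⟩ :- (pos (strict ⟨ vR ∷ vX ∷ vY ∷ [] ⟩) ∷ pos (loop-definitely ⟨ vY ∷ [] ⟩) ∷ []))
  ∷ (lambda ⟨ vX ∷ [] ⟩ :- (pos (definitely ⟨ vX ∷ [] ⟩) ∷ []))
  ∷ (lambda ⟨ vX ∷ [] ⟩ :- (pos (neg ⟨ vX ∷ vX' ∷ [] ⟩) ∷ naf (definitely ⟨ vX' ∷ [] ⟩)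
        ∷ pos (strict-or-defeasible ⟨ vR ∷ vX ∷ vY ∷ [] ⟩) ∷ pos (loop-lambda ⟨ vY ∷ [] ⟩) ∷ []))
  ∷ (defeasibly ⟨ vX ∷ [] ⟩ :- (pos (definitely ⟨ vX ∷ [] ⟩) ∷ []))
  ∷ (loopClauses loop-definitely definitely
  ++ loopClauses loop-lambda lambda
  ++ loopClauses loop-defeasibly defeasibly)

ambClauses : Program
ambClauses =
    (defeasibly ⟨ vX ∷ [] ⟩ :- (pos (neg ⟨ vX ∷ vX' ∷ [] ⟩) ∷ naf (definitely ⟨ vX' ∷ [] ⟩)
        ∷ pos (strict-or-defeasible ⟨ vR ∷ vX ∷ vY ∷ [] ⟩) ∷ pos (loop-defeasibly ⟨ vY ∷ [] ⟩)
        ∷ naf (overruled ⟨ vX ∷ [] ⟩) ∷ []))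
  ∷ (overruled ⟨ vX ∷ [] ⟩ :- (pos (neg ⟨ vX ∷ vX' ∷ [] ⟩) ∷ pos (rule ⟨ vS ∷ vX' ∷ vU ∷ [] ⟩)
        ∷ pos (loop-lambda ⟨ vU ∷ [] ⟩) ∷ naf (defeated ⟨ vS ∷ vX' ∷ [] ⟩) ∷ []))
  ∷ (defeated ⟨ vS ∷ vX' ∷ [] ⟩ :- (pos (neg ⟨ vX ∷ vX' ∷ [] ⟩) ∷ pos (sup ⟨ vT ∷ vS ∷ [] ⟩)
        ∷ pos (strict-or-defeasible ⟨ vT ∷ vX ∷ vV ∷ [] ⟩) ∷ pos (loop-defeasibly ⟨ vV ∷ [] ⟩) ∷ []))
  ∷ []

starClauses : Program
starClauses =
    (defeasibly ⟨ vX ∷ [] ⟩ :- (pos (neg ⟨ vX ∷ vX' ∷ [] ⟩) ∷ naf (definitely ⟨ vX' ∷ [] ⟩)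
        ∷ pos (strict-or-defeasible ⟨ vR ∷ vX ∷ vY ∷ [] ⟩) ∷ pos (loop-defeasibly ⟨ vY ∷ [] ⟩)
        ∷ naf (overruled ⟨ vR ∷ vX ∷ [] ⟩) ∷ []))
  ∷ (overruled ⟨ vR ∷ vX ∷ [] ⟩ :- (pos (neg ⟨ vX ∷ vX' ∷ [] ⟩) ∷ pos (rule ⟨ vS ∷ vX' ∷ vU ∷ [] ⟩)
        ∷ pos (loop-lambda ⟨ vU ∷ [] ⟩) ∷ naf (defeats ⟨ vR ∷ vS ∷ [] ⟩) ∷ []))
  ∷ (defeats ⟨ vR ∷ vS ∷ [] ⟩ :- (pos (sup ⟨ vR ∷ vS ∷ [] ⟩) ∷ []))
  ∷ []

M∂ : DefeasibleTheory → Program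
M∂ D = theoryClauses D ++ commonClauses ++ ambClauses

M∂* : DefeasibleTheory → Program
M∂* D = theoryClauses D ++ commonClauses ++ starClauses

data Sign : Set where
  plus minus : Sign

_·_ : Sign → Sign → Sign
plus · j = j
minus · plus = minus
minus · minus = plus

data Dep (P : Program) : MPred → Sign → MPred → Set where
  dep+ : ∀ {c a} → c ∈ P → pos a ∈ Clause.body c →
         Dep P (predOf (Clause.head c)) plus (predOf a)
  dep- : ∀ {c a} → c ∈ P → naf a ∈ Clause.body c →
         Dep P (predOf (Clause.head c)) minus (predOf a)

Dep₀ : Program → MPred → MPred → Set
Dep₀ P p q = ∃ λ i → Dep P p i q

DependsOn : Program → MPred → MPred → Set
DependsOn P = TransClosure (Dep₀ P)

data SDep (P : Program) : MPred → Sign → MPred → Set where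
  here  : ∀ {p} → SDep P p plus p
  there : ∀ {p q r i j} → Dep P p i q → SDep P q j r → SDep P p (i · j) r

PredSet : Set₁
PredSet = MPred → Set

IsSigning : Program → PredSet → (MPred → Sign) → Set
IsSigning P Q s = ∀ p q i → Q p → Q q → SDep P q i p → s p ≡ s q · i

Unfounded : Program → PredSet → (ℕ → Atom) → Set
Unfounded P Q f = ∀ i → Q (predOf (f i)) × Dep P (predOf (f i)) plus (predOf (f (suc i)))

AvoidsNegUnfounded : Program → PredSet → (MPred → Sign) → MPred → Set
AvoidsNegUnfounded P Q s p =
  ∀ q → s q ≡ minus → DependsOn P p q →
  ∀ (a : Atom) → predOf a ≡ q →
  ¬ (Σ (ℕ → Atom) λ f → f 0 ≡ a × Unfounded P Q f)

data 𝒬 : MPred → Set where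
  q-defeasibly      : 𝒬 defeasibly
  q-overruled       : 𝒬 overruled
  q-defeated        : 𝒬 defeated
  q-loop-defeasibly : 𝒬 loop-defeasibly

{-# OPTIONS --safe #-}
-- Sign every predicate +1 except overruled, which gets −1.  In both
-- metaprograms each dependency p ⊒ᵢ q with q ∈ 𝒬 has p ∈ 𝒬 and s q = s p · i,
-- so 𝒬 is closed backwards along ≥ and signs multiply along paths: s is a
-- signing.  The positive body literals of the overruled clause (neg, rule,
-- loop_lambda) lie outside 𝒬, so no unfounded sequence starts at an overruled
-- atom.  The clauses encoding D itself have empty bodies, so the check only
-- concerns the fixed clauses of the metaprograms and is done by evaluation.
module Submission where

open import Defs
open import Data.List using (List; []; _∷_; _++_; map; concatMap)
open import Data.List.Membership.Propositional using (_∈_)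
open import Data.List.Membership.Propositional.Properties using (∈-map⁺; ∈-concatMap⁺)
open import Data.List.Relation.Unary.All using (All; []; _∷_; all?; universal; lookup)
open import Data.List.Relation.Unary.All.Properties using (++⁺; map⁺; concat⁺)
open import Data.List.Relation.Unary.Any as Any using ()
open import Data.Product using (_×_; Σ; _,_; proj₁; proj₂)
open import Relation.Binary.PropositionalEquality using (_≡_; refl; sym; cong; subst; module ≡-Reasoning)
open import Relation.Nullary using (¬_; Dec; yes; no)
open import Relation.Nullary.Decidable using (_×-dec_; _→-dec_; ¬?; from-yes)
open import Relation.Unary using (Decidable)

·-identityʳ : ∀ i → i · plus ≡ i
·-identityʳ plus  = refl
·-identityʳ minus = refl

·-assoc : ∀ i j k → (i · j) · k ≡ i · (j · k)
·-assoc plus  j     k = refl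
·-assoc minus plus  k = refl
·-assoc minus minus plus  = refl
·-assoc minus minus minus = refl

infix 4 _≟ˢ_

_≟ˢ_ : (i j : Sign) → Dec (i ≡ j)
plus  ≟ˢ plus  = yes refl
plus  ≟ˢ minus = no λ ()
minus ≟ˢ plus  = no λ ()
minus ≟ˢ minus = yes refl

Edge : Set
Edge = MPred × Sign × MPred

litEdge : MPred → BodyLit → Edge
litEdge p (pos a) = p , plus  , predOf a
litEdge p (naf a) = p , minus , predOf a

clauseEdges : Clause → List Edge
clauseEdges (h :- b) = map (litEdge (predOf h)) b

edges : Program → List Edge
edges = concatMap clauseEdges

dep⇒∈edges : ∀ {P p i q} → Dep P p i q → (p , i , q) ∈ edges P
dep⇒∈edges (dep+ c∈P a∈b) = ∈-concatMap⁺ clauseEdges (Any.map (λ { refl → ∈-map⁺ _ a∈b }) c∈P)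
dep⇒∈edges (dep- c∈P a∈b) = ∈-concatMap⁺ clauseEdges (Any.map (λ { refl → ∈-map⁺ _ a∈b }) c∈P)

Bodiless : Clause → Set
Bodiless c = Clause.body c ≡ []

edges-++-bodiless : ∀ {P} R → All Bodiless P → edges (P ++ R) ≡ edges R
edges-++-bodiless R []         = refl
edges-++-bodiless R (refl ∷ ps) = edges-++-bodiless R ps

map-bodiless : ∀ {A : Set} (f : A → Clause) → (∀ x → Bodiless (f x)) → ∀ xs → All Bodiless (map f xs)
map-bodiless f f-bodiless xs = map⁺ (universal f-bodiless xs)

negClauses-bodiless : ∀ l → All Bodiless (negClauses l)
negClauses-bodiless _ = refl ∷ refl ∷ []

theoryClauses-bodiless : ∀ D → All Bodiless (theoryClauses D)
theoryClauses-bodiless D =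
  ++⁺ (map-bodiless factClause (λ _ → refl) facts)
    (++⁺ (map-bodiless ruleClause (λ _ → refl) rules)
      (++⁺ (map-bodiless supClause (λ _ → refl) (DefeasibleTheory.sup D))
        (concat⁺ (map⁺ (universal negClauses-bodiless (literalsOf D))))))
  where open DefeasibleTheory D using (facts; rules)

SignedInto : PredSet → (MPred → Sign) → MPred → Sign → MPred → Set
SignedInto Q s p i q = Q q → Q p × s q ≡ s p · i

module _ {P : Program} {Q : PredSet} {s : MPred → Sign} where

  sdep-source-in-Q : (∀ {p i q} → Dep P p i q → SignedInto Q s p i q) →
                ∀ {q i p} → SDep P q i p → Q p → Q q
  sdep-source-in-Q signed here        Qp = Qp
  sdep-source-in-Q signed (there d r) Qp = proj₁ (signed d (sdep-source-in-Q signed r Qp))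

  isSigning : (∀ {p i q} → Dep P p i q → SignedInto Q s p i q) → IsSigning P Q s
  isSigning signed p _ _ Qp _ = sign-along
    where
    sign-along : ∀ {q i} → SDep P q i p → s p ≡ s q · i
    sign-along {q} here = sym (·-identityʳ (s q))
    sign-along (there {p = q} {q = r} {i = i} {j = j} q⊒r r≥p) = begin
      s p             ≡⟨ sign-along r≥p ⟩
      s r · j         ≡⟨ cong (_· j) (proj₂ (signed q⊒r (sdep-source-in-Q signed r≥p Qp))) ⟩
      (s q · i) · j   ≡⟨ ·-assoc (s q) i j ⟩
      s q · (i · j)   ∎
      where open ≡-Reasoning

  avoidsNegUnfounded : (∀ {q r} → s q ≡ minus → Dep P q plus r → ¬ Q r) →
                       ∀ p → AvoidsNegUnfounded P Q s p
  avoidsNegUnfounded minus-leaves-Q _ q sq≡- _ a refl (f , refl , unfounded) =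
    minus-leaves-Q sq≡- (proj₂ (unfounded 0)) (proj₁ (unfounded 1))

overruled⁻ : MPred → Sign
overruled⁻ overruled = minus
overruled⁻ _         = plus

𝒬? : Decidable 𝒬
𝒬? defeasibly           = yes q-defeasibly
𝒬? overruled            = yes q-overruled
𝒬? defeated             = yes q-defeated
𝒬? loop-defeasibly      = yes q-loop-defeasibly
𝒬? fact                 = no λ ()
𝒬? strict               = no λ ()
𝒬? defeasible           = no λ ()
𝒬? defeater             = no λ ()
𝒬? sup                  = no λ ()
𝒬? neg                  = no λ ()
𝒬? rule                 = no λ ()
𝒬? strict-or-defeasible = no λ ()
𝒬? loop-definitely      = no λ ()
𝒬? loop-lambda          = no λ ()
𝒬? definitely           = no λ ()
𝒬? lambda               = no λ ()
𝒬? defeats              = no λ ()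

Admissible : Edge → Set
Admissible (p , i , q) =
  SignedInto 𝒬 overruled⁻ p i q × (overruled⁻ p ≡ minus → i ≡ plus → ¬ 𝒬 q)

admissible? : Decidable Admissible
admissible? (p , i , q) =
  (𝒬? q →-dec 𝒬? p ×-dec overruled⁻ q ≟ˢ overruled⁻ p · i)
  ×-dec (overruled⁻ p ≟ˢ minus →-dec i ≟ˢ plus →-dec ¬? (𝒬? q))

signing-avoiding : ∀ D R → All Admissible (edges R) →
  Σ (MPred → Sign) λ s → IsSigning (theoryClauses D ++ R) 𝒬 s × s defeasibly ≡ plus
    × AvoidsNegUnfounded (theoryClauses D ++ R) 𝒬 s defeasibly
signing-avoiding D R admissible =
  overruled⁻ ,
  isSigning (λ d → proj₁ (admissible-dep d)) ,
  refl ,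
  avoidsNegUnfounded (λ sq≡- d → proj₂ (admissible-dep d) sq≡- refl) defeasibly
  where
  admissible-dep : ∀ {p i q} → Dep (theoryClauses D ++ R) p i q → Admissible (p , i , q)
  admissible-dep d = lookup admissible
    (subst (_ ∈_) (edges-++-bodiless R (theoryClauses-bodiless D)) (dep⇒∈edges d))

proposition2 : (D : DefeasibleTheory) →
    (Σ (MPred → Sign) λ s → IsSigning (M∂ D) 𝒬 s × s defeasibly ≡ plus
        × AvoidsNegUnfounded (M∂ D) 𝒬 s defeasibly)
    × (Σ (MPred → Sign) λ s → IsSigning (M∂* D) 𝒬 s × s defeasibly ≡ plus
        × AvoidsNegUnfounded (M∂* D) 𝒬 s defeasibly)
proposition2 D =
  signing-avoiding D _ (from-yes (all? admissible? (edges (commonClauses ++ ambClauses)))) ,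
  signing-avoiding D _ (from-yes (all? admissible? (edges (commonClauses ++ starClauses))))
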